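{- Let $P_5$ be the path on $5$ vertices. Then ${\rm im}(\mu_m(P_5))=4$ for $m=1,2$, and ${\rm im}(\mu_m(P_5))=5$ for every integer $m\ge 3$.
   Context: For graphs $G$ and $H$, $G$ has an $H$-immersion if there is a one-to-one map $\phi:V(H)\to V(G)$ such that for each edge $uv\in E(H)$ there is a path $P_{uv}$ in $G$ joining $\phi(u)$ and $\phi(v)$, with the paths $P_{uv}$ pairwise edge-disjoint. The immersion number ${\rm im}(G)$ is the largest $t$ such that $G$ has a $K_t$-immersion. For an integer $m\ge1$, the $m$-Mycielskian $\mu_m(G)$ is the graph with vertex set $(V(G)\times\{0,1,\dots,m-1\})\cup\{w\}$ and edges $(u,0)(v,0)$ and $(u,i)(v,i+1)$ for all $uv\in E(G)$ (with $(u,i)(v,i+1)$ for $0\le i\le m-2$, in both orientations of $uv$), together with edges $(u,m-1)w$ for all $u\in V(G)$. -}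

module Defs where

open import Data.Nat using (ℕ; zero; suc; _≤_; _<_)
open import Data.Fin using (Fin; toℕ)
open import Data.Fin.Properties using ()
open import Data.Maybe using (Maybe; just; nothing)
open import Data.Product using (_×_; _,_; Σ)
open import Data.Sum using (_⊎_)
open import Data.List using (List; []; _∷_)
open import Data.List.Relation.Unary.Unique.Propositional using (Unique)
open import Data.Empty using (⊥)
open import Relation.Nullary using (¬_)
open import Relation.Binary.PropositionalEquality using (_≡_)
open import Function.Definitions using (Injective)
open import Level using (0ℓ)

record Graph : Set₁ where
  field
    V   : Set
    Adj : V → V → Set
open Graph public

data Walk (G : Graph) : V G → V G → Set where
  [_] : (x : V G) → Walk G x x
  _∷_ : {x y z : V G} → Adj G x y → Walk G y z → Walk G x z

vertices : {G : Graph} {x y : V G} → Walk G x y → List (V G)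
vertices ([ x ]) = x ∷ []
vertices {x = x} (_ ∷ w) = x ∷ vertices w

record Path (G : Graph) (x y : V G) : Set where
  field
    walk     : Walk G x y
    distinct : Unique (vertices walk)
open Path public

data Step {G : Graph} (a b : V G) : {x y : V G} → Walk G x y → Set where
  here  : {z : V G} (e : Adj G a b) (w : Walk G b z) → Step a b (e ∷ w)
  there : {x y z : V G} (e : Adj G x y) {w : Walk G y z} → Step a b w → Step a b (e ∷ w)

UsesEdge : {G : Graph} {x y : V G} → Path G x y → V G → V G → Set
UsesEdge P a b = Step a b (walk P) ⊎ Step b a (walk P)

record KImmersion (G : Graph) (t : ℕ) : Set where
  field
    φ        : Fin t → V G
    φ-inj    : Injective _≡_ _≡_ φ
    route    : (i j : Fin t) → i Data.Fin.< j → Path G (φ i) (φ j)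
    disjoint : (i j : Fin t) (p : i Data.Fin.< j) (k l : Fin t) (q : k Data.Fin.< l) →
               ¬ ((i , j) ≡ (k , l)) → (a b : V G) →
               UsesEdge (route i j p) a b → UsesEdge (route k l q) a b → ⊥

ImmersionNumberIs : Graph → ℕ → Set
ImmersionNumberIs G k = KImmersion G k × ((t : ℕ) → KImmersion G t → t ≤ k)

P₅ : Graph
P₅ = record { V = Fin 5 ; Adj = λ i j → (suc (toℕ i) ≡ toℕ j) ⊎ (suc (toℕ j) ≡ toℕ i) }

-- m-Mycielskian; vertex (u , i) is just (u , i), and w is nothing
data MycAdj (G : Graph) (m : ℕ) : Maybe (V G × Fin m) → Maybe (V G × Fin m) → Set where
  level0 : {u v : V G} {i j : Fin m} → Adj G u v → toℕ i ≡ 0 → toℕ j ≡ 0 →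
           MycAdj G m (just (u , i)) (just (v , j))
  up     : {u v : V G} {i j : Fin m} → Adj G u v → suc (toℕ i) ≡ toℕ j →
           MycAdj G m (just (u , i)) (just (v , j))
  down   : {u v : V G} {i j : Fin m} → Adj G u v → toℕ i ≡ suc (toℕ j) →
           MycAdj G m (just (u , i)) (just (v , j))
  toW    : {u : V G} {i : Fin m} → suc (toℕ i) ≡ m → MycAdj G m (just (u , i)) nothing
  fromW  : {u : V G} {i : Fin m} → suc (toℕ i) ≡ m → MycAdj G m nothing (just (u , i))

μ : ℕ → Graph → Graph
μ m G = record { V = Maybe (V G × Fin m) ; Adj = MycAdj G m }

-- In a K_t-immersion every branch vertex has t - 1 distinct neighbours: the routes to the other branch
-- vertices are edge-disjoint, so they leave it along different edges.  In μ_m(P₅) a vertex (u , i) has at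
-- most four neighbours (two columns, one level down or up), so only w can be a branch vertex of a
-- K₆-immersion, and t ≤ 5.  For m = 1 every vertex but w has degree at most 3; for m = 2 only w, (1,0),
-- (2,0) and (3,0) have degree 4, too few for a K₅.  The matching immersions are explicit; their
-- edge-disjointness is certified by labelling every edge with the one route allowed to use it.  For m ≥ 3
-- the four routes to w climb ladders alternating between the columns 0, 1 or 3, 4, which needs a level 2.

module Submission where

open import Defs
open import Data.Bool using (Bool; true; false; not)
open import Data.Bool.Properties using (not-involutive)
open import Data.Empty using (⊥-elim)
open import Data.Fin using (Fin; zero; suc; toℕ; fromℕ<; punchIn; punchOut) renaming (_<_ to _<ᶠ_)
open import Data.Fin.Patterns using (0F; 1F; 2F; 3F; 4F)
open import Data.Fin.Properties
  using (toℕ-injective; toℕ<n; toℕ-fromℕ<; injective⇒≤; punchIn-injective; punchInᵢ≢i; punchOut-injective; <-cmp)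
  renaming (_≟_ to _≟ᶠ_)
open import Data.List using (List; []; _∷_; length; lookup)
open import Data.List.Membership.Propositional using (_∈_)
open import Data.List.Relation.Unary.All using (All; []; _∷_)
import Data.List.Relation.Unary.All as All
open import Data.List.Relation.Unary.AllPairs using ([]; _∷_)
open import Data.List.Relation.Unary.Any using (here; there; index)
open import Data.List.Relation.Unary.Any.Properties using (lookup-index)
open import Data.List.Relation.Unary.Unique.DecPropositional using (unique?)
open import Data.List.Relation.Unary.Unique.Propositional using (Unique)
open import Data.Maybe using (Maybe; just; nothing; _<∣>_)
open import Data.Maybe.Properties using (just-injective) renaming (≡-dec to Maybe-≡-dec)
open import Data.Nat using (ℕ; zero; suc; pred; _+_; _≤_; _<_; _⊔_; z≤n; s≤s; z<s; _≟_; _≤?_)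
open import Data.Nat.Properties
  using (1+n≰n; <-irrefl; ≤-refl; ≤-trans; n≤1+n; <⇒≱; ≰⇒>; m≤n⇒m≤n⊔o; m≤n⇒m≤o⊔n; +-identityʳ; +-suc; m<m+n)
open import Data.Product using (Σ-syntax; _×_; _,_; proj₁; proj₂)
open import Data.Product.Properties using () renaming (≡-dec to ×-≡-dec)
open import Data.Sum using (_⊎_; inj₁; inj₂)
open import Data.Unit using (⊤; tt)
open import Function using (_∘_)
open import Function.Definitions using (Injective)
open import Relation.Binary using (tri<; tri≈; tri>)
open import Relation.Binary.Definitions using (DecidableEquality)
open import Relation.Binary.PropositionalEquality
  using (_≡_; _≢_; refl; sym; trans; cong; cong₂; subst; module ≡-Reasoning)
open import Relation.Nullary using (Dec; yes; no)
open import Relation.Nullary.Decidable using (True; toWitness; _×-dec_)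

-- Degrees and immersions

module _ (G : Graph) where

  record DegreeAtLeast (x : V G) (n : ℕ) : Set where
    field
      neighbour           : Fin n → V G
      adjacent            : ∀ k → Adj G x (neighbour k)
      neighbour-injective : Injective _≡_ _≡_ neighbour

  record NeighbourCode (x : V G) (c : ℕ) : Set where
    field
      code           : ∀ {y} → Adj G x y → Fin c
      code-injective : ∀ {y₁ y₂} (a₁ : Adj G x y₁) (a₂ : Adj G x y₂) → code a₁ ≡ code a₂ → y₁ ≡ y₂

  open DegreeAtLeast
  open NeighbourCode

  degree≤ : ∀ {x c n} → NeighbourCode x c → DegreeAtLeast x n → n ≤ c
  degree≤ κ d = injective⇒≤ (neighbour-injective d ∘ code-injective κ (adjacent d _) (adjacent d _))

  shrink-code : ∀ {x c} (κ : NeighbourCode x (suc c)) (c₀ : Fin (suc c)) →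
             (∀ {y} (a : Adj G x y) → code κ a ≢ c₀) → NeighbourCode x c
  shrink-code κ c₀ unused = record
    { code           = λ a → punchOut (unused a ∘ sym)
    ; code-injective = λ a₁ a₂ → code-injective κ a₁ a₂ ∘ punchOut-injective (unused a₁ ∘ sym) (unused a₂ ∘ sym)
    }

  first-edge : ∀ {x y} (w : Walk G x y) → x ≢ y → Σ[ z ∈ V G ] Adj G x z × Step x z w
  first-edge [ x ]   x≢x = ⊥-elim (x≢x refl)
  first-edge (e ∷ w) _   = _ , e , here e w

  last-edge-∷ : ∀ {x y z} (e : Adj G x y) (w : Walk G y z) → Σ[ v ∈ V G ] Adj G v z × Step v z (e ∷ w)
  last-edge-∷ e [ _ ]    = _ , e , here e _
  last-edge-∷ e (f ∷ w) with last-edge-∷ f w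
  ... | v , a , s = v , a , there e s

  last-edge : ∀ {x y} (w : Walk G x y) → x ≢ y → Σ[ v ∈ V G ] Adj G v y × Step v y w
  last-edge [ x ]   x≢x = ⊥-elim (x≢x refl)
  last-edge (e ∷ w) _   = last-edge-∷ e w

other-end-unique : ∀ {A : Set} {i j₁ j₂ a b : A} → j₁ ≢ i →
                   (a , b) ≡ (i , j₁) ⊎ (a , b) ≡ (j₁ , i) → (a , b) ≡ (i , j₂) ⊎ (a , b) ≡ (j₂ , i) → j₁ ≡ j₂
other-end-unique _    (inj₁ refl) (inj₁ refl) = refl
other-end-unique j₁≢i (inj₁ refl) (inj₂ refl) = ⊥-elim (j₁≢i refl)
other-end-unique j₁≢i (inj₂ refl) (inj₁ refl) = ⊥-elim (j₁≢i refl)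
other-end-unique _    (inj₂ refl) (inj₂ refl) = refl

module _ {G : Graph} (Adj-sym : ∀ {x y} → Adj G x y → Adj G y x) where

  module _ {t : ℕ} (K : KImmersion G t) where
    open KImmersion K

    record Departure (i j : Fin t) : Set where
      field
        a b      : Fin t
        a<b      : a <ᶠ b
        ends     : (a , b) ≡ (i , j) ⊎ (a , b) ≡ (j , i)
        next     : V G
        adjacent : Adj G (φ i) next
        uses     : UsesEdge (route a b a<b) (φ i) next
    open Departure

    departure : ∀ i j → j ≢ i → Departure i j
    departure i j j≢i with <-cmp i j
    ... | tri≈ _ i≡j _ = ⊥-elim (j≢i (sym i≡j))
    ... | tri< i<j _ _ with first-edge G (walk (route i j i<j)) (j≢i ∘ sym ∘ φ-inj)
    ...   | y , e , s =
      record { a = i ; b = j ; a<b = i<j ; ends = inj₁ refl ; next = y ; adjacent = e ; uses = inj₁ s }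
    departure i j j≢i | tri> _ _ j<i with last-edge G (walk (route j i j<i)) (j≢i ∘ φ-inj)
    ...   | y , e , s =
      record { a = j ; b = i ; a<b = j<i ; ends = inj₂ refl ; next = y ; adjacent = Adj-sym e ; uses = inj₂ s }

    -- Two departures from φ i along the same edge lie on the same route (routes are edge-disjoint),
    -- whose other end is then determined.
    departure-injective : ∀ {i j₁ j₂} (d₁ : Departure i j₁) (d₂ : Departure i j₂) → j₁ ≢ i →
                          next d₁ ≡ next d₂ → j₁ ≡ j₂
    departure-injective {i} d₁ d₂ j₁≢i same-next with ×-≡-dec _≟ᶠ_ _≟ᶠ_ (a d₁ , b d₁) (a d₂ , b d₂)
    ... | yes same-route =
      other-end-unique j₁≢i (ends d₁) (Data.Sum.map (trans same-route) (trans same-route) (ends d₂))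
    ... | no other-route = ⊥-elim (disjoint _ _ (a<b d₁) _ _ (a<b d₂) other-route (φ i) (next d₁) (uses d₁)
                                     (subst (UsesEdge (route _ _ (a<b d₂)) (φ i)) (sym same-next) (uses d₂)))

  branch-degree : ∀ {n} (K : KImmersion G (suc n)) i → DegreeAtLeast G (KImmersion.φ K i) n
  branch-degree K i = record
    { neighbour           = Departure.next ∘ leg
    ; adjacent            = Departure.adjacent ∘ leg
    ; neighbour-injective = λ {k₁} {k₂} →
        punchIn-injective i k₁ k₂ ∘ departure-injective K (leg k₁) (leg k₂) (punchInᵢ≢i i k₁)
    }
    where
    leg : ∀ k → Departure K i (punchIn i k)
    leg k = departure K i (punchIn i k) (punchInᵢ≢i i k)

  -- In a K_t-immersion with t > d the branch vertices have degree at least d, so they inject into the hubs.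
  immersion-size≤ : ∀ d (hubs : List (V G)) → (∀ {x n} → d ≤ n → DegreeAtLeast G x n → x ∈ hubs) →
                    ∀ {t} → KImmersion G t → t ≤ d ⊔ length hubs
  immersion-size≤ d hubs hub {zero}  K = z≤n
  immersion-size≤ d hubs hub {suc n} K with d ≤? n
  ... | no d≰n  = m≤n⇒m≤n⊔o (length hubs) (≰⇒> d≰n)
  ... | yes d≤n = m≤n⇒m≤o⊔n d (injective⇒≤ position-injective)
    where
    open KImmersion K
    position : Fin (suc n) → Fin (length hubs)
    position i = index (hub d≤n (branch-degree K i))
    position-injective : Injective _≡_ _≡_ position
    position-injective {i} {j} same = φ-inj (begin
      φ i                           ≡⟨ lookup-index (hub d≤n (branch-degree K i)) ⟩
      lookup hubs (position i)      ≡⟨ cong (lookup hubs) same ⟩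
      lookup hubs (position j)      ≡⟨ sym (lookup-index (hub d≤n (branch-degree K j))) ⟩
      φ j                           ∎)
      where open ≡-Reasoning

-- Immersions from edge labellings

infixr 5 _⟶⟨_⟩_
_⟶⟨_⟩_ : ∀ {G : Graph} (x : V G) {y z} → Adj G x y → Walk G y z → Walk G x z
x ⟶⟨ e ⟩ w = e ∷ w

module Labelling {G : Graph} (_≟_ : DecidableEquality (V G)) {t : ℕ} (label : V G → V G → Maybe (Fin t × Fin t)) where

  -- label x y ≡ just (i , j) reserves the edge xy for the route between the i-th and j-th branch vertices.
  Labelled : ∀ {x y} → Fin t × Fin t → Walk G x y → Set
  Labelled p [ _ ]                 = ⊤
  Labelled p (_∷_ {x} {y} _ w) = (label x y ≡ just p × label y x ≡ just p) × Labelled p w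

  labelled? : ∀ {x y} p (w : Walk G x y) → Dec (Labelled p w)
  labelled? p [ _ ]               = yes tt
  labelled? p (_∷_ {x} {y} _ w) = ((label x y ≟ᴸ just p) ×-dec (label y x ≟ᴸ just p)) ×-dec labelled? p w
    where _≟ᴸ_ = Maybe-≡-dec (×-≡-dec _≟ᶠ_ _≟ᶠ_)

  labelled-step : ∀ {x y a b p} {w : Walk G x y} → Labelled p w → Step a b w → label a b ≡ just p × label b a ≡ just p
  labelled-step (ok , _)    (here _ _)  = ok
  labelled-step (_  , rest) (there _ s) = labelled-step rest s

  labelled-uses : ∀ {x y a b p} {P : Path G x y} → Labelled p (walk P) → UsesEdge P a b → label a b ≡ just p
  labelled-uses ok (inj₁ s) = proj₁ (labelled-step ok s)
  labelled-uses ok (inj₂ s) = proj₂ (labelled-step ok s)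

  LabelledPath : V G → V G → Fin t × Fin t → Set
  LabelledPath x y p = Σ[ P ∈ Path G x y ] Labelled p (walk P)

  labelled-path : ∀ {x y p} (w : Walk G x y) →
                  {_ : True (unique? _≟_ (vertices w))} {_ : True (labelled? p w)} → LabelledPath x y p
  labelled-path w {distinct} {ok} = record { walk = w ; distinct = toWitness distinct } , toWitness ok

  labelled-immersion : (φ : Fin t → V G) (ψ : V G → Fin t) → (∀ i → ψ (φ i) ≡ i) →
                       ((i j : Fin t) → i <ᶠ j → LabelledPath (φ i) (φ j) (i , j)) → KImmersion G t
  labelled-immersion φ ψ ψ∘φ routes = record
    { φ        = φ
    ; φ-inj    = λ {i} {j} φi≡φj → trans (sym (ψ∘φ i)) (trans (cong ψ φi≡φj) (ψ∘φ j))
    ; route    = λ i j i<j → proj₁ (routes i j i<j)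
    ; disjoint = λ i j i<j k l k<l ij≢kl a b uses₁ uses₂ →
        ij≢kl (just-injective (trans (sym (reserved-for i j i<j uses₁)) (reserved-for k l k<l uses₂)))
    }
    where
    reserved-for : ∀ i j i<j {a b} → UsesEdge (proj₁ (routes i j i<j)) a b → label a b ≡ just (i , j)
    reserved-for i j i<j = labelled-uses {P = proj₁ (routes i j i<j)} (proj₂ (routes i j i<j))

-- Ladders in a Mycielskian

MycAdj-sym : ∀ {G : Graph} {m} → (∀ {x y} → Adj G x y → Adj G y x) → ∀ {x y} → MycAdj G m x y → MycAdj G m y x
MycAdj-sym sym-G (level0 e i≡0 j≡0) = level0 (sym-G e) j≡0 i≡0
MycAdj-sym sym-G (up e i+1≡j)       = down (sym-G e) (sym i+1≡j)
MycAdj-sym sym-G (down e i≡j+1)     = up (sym-G e) (sym i≡j+1)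
MycAdj-sym sym-G (toW top)          = fromW top
MycAdj-sym sym-G (fromW top)        = toW top

module Ladder {G : Graph} (Adj-sym : ∀ {x y} → Adj G x y → Adj G y x) (m : ℕ) where

  next-level<m : (i : Fin m) (d : ℕ) → suc (toℕ i + suc d) ≡ m → suc (toℕ i) < m
  next-level<m i d top = subst (suc (toℕ i) <_) top (s≤s (m<m+n (toℕ i) z<s))

  next-level : (i : Fin m) (d : ℕ) → suc (toℕ i + suc d) ≡ m → Fin m
  next-level i d top = fromℕ< (next-level<m i d top)

  toℕ-next-level : (i : Fin m) (d : ℕ) (top : suc (toℕ i + suc d) ≡ m) → toℕ (next-level i d top) ≡ suc (toℕ i)
  toℕ-next-level i d top = toℕ-fromℕ< (next-level<m i d top)

  next-level-top : (i : Fin m) (d : ℕ) (top : suc (toℕ i + suc d) ≡ m) → suc (toℕ (next-level i d top) + d) ≡ m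
  next-level-top i d top = begin
    suc (toℕ (next-level i d top) + d) ≡⟨ cong (λ l → suc (l + d)) (toℕ-next-level i d top) ⟩
    suc (suc (toℕ i) + d)              ≡⟨ cong suc (sym (+-suc (toℕ i) d)) ⟩
    suc (toℕ i + suc d)                ≡⟨ top ⟩
    m                                  ∎
    where open ≡-Reasoning

  -- The walk (a , i), (b , i + 1), (a , i + 2), … up to the top level i + d, and then to w.
  ladder : ∀ {a b} → Adj G a b → (i : Fin m) (d : ℕ) → suc (toℕ i + d) ≡ m → Walk (μ m G) (just (a , i)) nothing
  ladder ab i zero    top = toW (trans (cong suc (sym (+-identityʳ (toℕ i)))) top) ∷ [ nothing ]
  ladder ab i (suc d) top =
    up ab (sym (toℕ-next-level i d top)) ∷ ladder (Adj-sym ab) (next-level i d top) d (next-level-top i d top)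

  AboveLevel : ℕ → V (μ m G) → Set
  AboveLevel n nothing        = ⊤
  AboveLevel n (just (_ , l)) = n ≤ toℕ l

  ladder-above : ∀ {a b} (ab : Adj G a b) i d top → All (AboveLevel (toℕ i)) (vertices (ladder ab i d top))
  ladder-above ab i zero    top = ≤-refl ∷ tt ∷ []
  ladder-above ab i (suc d) top = ≤-refl ∷ All.map raise (ladder-above (Adj-sym ab) _ d (next-level-top i d top))
    where
    raise : ∀ {x} → AboveLevel (toℕ (next-level i d top)) x → AboveLevel (toℕ i) x
    raise {nothing} _          = tt
    raise {just _}  next≤l = ≤-trans (n≤1+n (toℕ i)) (subst (_≤ _) (toℕ-next-level i d top) next≤l)

  below-ladder : ∀ {a b u} {l : Fin m} (ab : Adj G a b) i d top → toℕ l < toℕ i →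
                 All (just (u , l) ≢_) (vertices (ladder ab i d top))
  below-ladder ab i d top l<i = All.map (λ {x} → not-above {x}) (ladder-above ab i d top)
    where
    not-above : ∀ {x} → AboveLevel (toℕ i) x → just (_ , _) ≢ x
    not-above {just _} i≤l refl = <⇒≱ l<i i≤l

  ladder-unique : ∀ {a b} (ab : Adj G a b) i d top → Unique (vertices (ladder ab i d top))
  ladder-unique ab i zero    top = ((λ ()) ∷ []) ∷ [] ∷ []
  ladder-unique ab i (suc d) top =
    below-ladder (Adj-sym ab) _ d (next-level-top i d top) (subst (toℕ i <_) (sym (toℕ-next-level i d top)) ≤-refl)
    ∷ ladder-unique (Adj-sym ab) _ d (next-level-top i d top)

-- The immersion number of μ_m(P₅)

P₅-sym : ∀ {u v} → Adj P₅ u v → Adj P₅ v u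
P₅-sym (inj₁ right) = inj₂ right
P₅-sym (inj₂ left)  = inj₁ left

module Directions (m : ℕ) where

  coords : V (μ m P₅) → Maybe (ℕ × ℕ)
  coords nothing        = nothing
  coords (just (u , i)) = just (toℕ u , toℕ i)

  coords-injective : Injective _≡_ _≡_ coords
  coords-injective {nothing} {nothing} _ = refl
  coords-injective {just _} {just _} same = cong₂ (λ u i → just (u , i))
    (toℕ-injective (cong proj₁ (just-injective same))) (toℕ-injective (cong proj₂ (just-injective same)))

  -- 0F, 1F: right, left column on the level below (or on level 0, hence pred 0 = 0 in towards); 2F, 3F: right,
  -- left column on the level above.  Only the top level is adjacent to w, and it has no level above, so w can
  -- share the direction 3F.
  direction : ∀ {u i y} → MycAdj P₅ m (just (u , i)) y → Fin 4
  direction (level0 (inj₁ _) _ _) = 0F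
  direction (level0 (inj₂ _) _ _) = 1F
  direction (down (inj₁ _) _)     = 0F
  direction (down (inj₂ _) _)     = 1F
  direction (up (inj₁ _) _)       = 2F
  direction (up (inj₂ _) _)       = 3F
  direction (toW _)               = 3F

  towards : ℕ → ℕ → Fin 4 → Maybe (ℕ × ℕ)
  towards u i 0F = just (suc u , pred i)
  towards u i 1F = just (pred u , pred i)
  towards u i 2F = just (suc u , suc i)
  towards u i 3F with suc i ≟ m
  ... | yes _ = nothing
  ... | no _  = just (pred u , suc i)

  coords≡ : ∀ {v : Fin 5} {j : Fin m} {a b} → toℕ v ≡ a → toℕ j ≡ b → coords (just (v , j)) ≡ just (a , b)
  coords≡ refl refl = refl

  towards-direction : ∀ {u i y} (a : MycAdj P₅ m (just (u , i)) y) → coords y ≡ towards (toℕ u) (toℕ i) (direction a)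
  towards-direction (level0 (inj₁ u+1≡v) i≡0 j≡0) = coords≡ (sym u+1≡v) (trans j≡0 (sym (cong pred i≡0)))
  towards-direction (level0 (inj₂ v+1≡u) i≡0 j≡0) = coords≡ (cong pred v+1≡u) (trans j≡0 (sym (cong pred i≡0)))
  towards-direction (down (inj₁ u+1≡v) i≡j+1)     = coords≡ (sym u+1≡v) (cong pred (sym i≡j+1))
  towards-direction (down (inj₂ v+1≡u) i≡j+1)     = coords≡ (cong pred v+1≡u) (cong pred (sym i≡j+1))
  towards-direction (up (inj₁ u+1≡v) i+1≡j)       = coords≡ (sym u+1≡v) (sym i+1≡j)
  towards-direction {i = i} (up {j = j} (inj₂ v+1≡u) i+1≡j) with suc (toℕ i) ≟ m
  ... | yes top = ⊥-elim (<-irrefl (trans (sym i+1≡j) top) (toℕ<n j))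
  ... | no _    = coords≡ (cong pred v+1≡u) (sym i+1≡j)
  towards-direction {i = i} (toW top) with suc (toℕ i) ≟ m
  ... | yes _       = refl
  ... | no not-top = ⊥-elim (not-top top)


  directions : ∀ {u i} → NeighbourCode (μ m P₅) (just (u , i)) 4
  directions {u} {i} = record
    { code           = direction
    ; code-injective = λ a₁ a₂ same → coords-injective (begin
        coords _                                 ≡⟨ towards-direction a₁ ⟩
        towards (toℕ u) (toℕ i) (direction a₁) ≡⟨ cong (towards (toℕ u) (toℕ i)) same ⟩
        towards (toℕ u) (toℕ i) (direction a₂) ≡⟨ sym (towards-direction a₂) ⟩
        coords _                                 ∎)
    }
    where open ≡-Reasoning

  top-level-no-up : ∀ {u i y} → suc (toℕ i) ≡ m → (a : MycAdj P₅ m (just (u , i)) y) → direction a ≢ 2F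
  top-level-no-up top (up {j = j} (inj₁ _) i+1≡j) _ = <-irrefl (trans (sym i+1≡j) top) (toℕ<n j)
  top-level-no-up top (level0 (inj₁ _) _ _) ()
  top-level-no-up top (level0 (inj₂ _) _ _) ()
  top-level-no-up top (down (inj₁ _) _)     ()
  top-level-no-up top (down (inj₂ _) _)     ()
  top-level-no-up top (up (inj₂ _) _)       ()
  top-level-no-up top (toW _)               ()

  left-end-no-left : ∀ {i y} (a : MycAdj P₅ m (just (0F , i)) y) → direction a ≢ 1F
  left-end-no-left (level0 (inj₁ _) _ _) ()
  left-end-no-left (level0 (inj₂ ()) _ _)
  left-end-no-left (down (inj₁ _) _)     ()
  left-end-no-left (down (inj₂ ()) _)
  left-end-no-left (up (inj₁ _) _)       ()
  left-end-no-left (up (inj₂ _) _)       ()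
  left-end-no-left (toW _)               ()

  right-end-no-right : ∀ {i y} (a : MycAdj P₅ m (just (4F , i)) y) → direction a ≢ 0F
  right-end-no-right (level0 {v = v} (inj₁ 5≡v) _ _) _ = <-irrefl (sym 5≡v) (toℕ<n v)
  right-end-no-right (down {v = v} (inj₁ 5≡v) _)     _ = <-irrefl (sym 5≡v) (toℕ<n v)
  right-end-no-right (level0 (inj₂ _) _ _) ()
  right-end-no-right (down (inj₂ _) _)     ()
  right-end-no-right (up (inj₁ _) _)       ()
  right-end-no-right (up (inj₂ _) _)       ()
  right-end-no-right (toW _)               ()

  degree≤4 : ∀ {u i n} → DegreeAtLeast (μ m P₅) (just (u , i)) n → n ≤ 4
  degree≤4 = degree≤ _ directions

  top-degree≤3 : ∀ {u i n} → suc (toℕ i) ≡ m → DegreeAtLeast (μ m P₅) (just (u , i)) n → n ≤ 3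
  top-degree≤3 top = degree≤ _ (shrink-code _ directions 2F (top-level-no-up top))

  left-end-degree≤3 : ∀ {i n} → DegreeAtLeast (μ m P₅) (just (0F , i)) n → n ≤ 3
  left-end-degree≤3 = degree≤ _ (shrink-code _ directions 1F left-end-no-left)

  right-end-degree≤3 : ∀ {i n} → DegreeAtLeast (μ m P₅) (just (4F , i)) n → n ≤ 3
  right-end-degree≤3 = degree≤ _ (shrink-code _ directions 0F right-end-no-right)

im-μ≤5 : ∀ {m t} → KImmersion (μ m P₅) t → t ≤ 5
im-μ≤5 {m} = immersion-size≤ (MycAdj-sym P₅-sym) 5 (nothing ∷ []) hub
  where
  hub : ∀ {x n} → 5 ≤ n → DegreeAtLeast (μ m P₅) x n → x ∈ nothing ∷ []
  hub {nothing} _   _ = here refl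
  hub {just _}  5≤n d = ⊥-elim (1+n≰n (≤-trans 5≤n (Directions.degree≤4 m d)))

im-μ₁≤4 : ∀ {t} → KImmersion (μ 1 P₅) t → t ≤ 4
im-μ₁≤4 = immersion-size≤ (MycAdj-sym P₅-sym) 4 (nothing ∷ []) hub
  where
  hub : ∀ {x n} → 4 ≤ n → DegreeAtLeast (μ 1 P₅) x n → x ∈ nothing ∷ []
  hub {nothing}      _   _ = here refl
  hub {just (_ , 0F)} 4≤n d = ⊥-elim (1+n≰n (≤-trans 4≤n (Directions.top-degree≤3 1 refl d)))

im-μ₂≤4 : ∀ {t} → KImmersion (μ 2 P₅) t → t ≤ 4
im-μ₂≤4 = immersion-size≤ (MycAdj-sym P₅-sym) 4 (nothing ∷ just (1F , 0F) ∷ just (2F , 0F) ∷ just (3F , 0F) ∷ []) hub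
  where
  open Directions 2
  hub : ∀ {x n} → 4 ≤ n → DegreeAtLeast (μ 2 P₅) x n →
        x ∈ nothing ∷ just (1F , 0F) ∷ just (2F , 0F) ∷ just (3F , 0F) ∷ []
  hub {nothing}        _   _ = here refl
  hub {just (1F , 0F)} _   _ = there (here refl)
  hub {just (2F , 0F)} _   _ = there (there (here refl))
  hub {just (3F , 0F)} _   _ = there (there (there (here refl)))
  hub {just (0F , 0F)} 4≤n d = ⊥-elim (1+n≰n (≤-trans 4≤n (left-end-degree≤3 d)))
  hub {just (4F , 0F)} 4≤n d = ⊥-elim (1+n≰n (≤-trans 4≤n (right-end-degree≤3 d)))
  hub {just (_ , 1F)}  4≤n d = ⊥-elim (1+n≰n (≤-trans 4≤n (top-degree≤3 refl d)))

_≟ᵥ_ : ∀ {m} → DecidableEquality (V (μ m P₅))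
_≟ᵥ_ = Maybe-≡-dec (×-≡-dec _≟ᶠ_ _≟ᶠ_)

either-way : {A B : Set} → (A → A → Maybe B) → A → A → Maybe B
either-way f x y = f x y <∣> f y x

K₄-in-μ₁ : KImmersion (μ 1 P₅) 4
K₄-in-μ₁ = labelled-immersion φ ψ (λ { 0F → refl ; 1F → refl ; 2F → refl ; 3F → refl }) routes
  where
  φ : Fin 4 → V (μ 1 P₅)
  φ 0F = just (1F , 0F)
  φ 1F = just (2F , 0F)
  φ 2F = just (3F , 0F)
  φ 3F = nothing

  ψ : V (μ 1 P₅) → Fin 4
  ψ (just (2F , 0F)) = 1F
  ψ (just (3F , 0F)) = 2F
  ψ nothing          = 3F
  ψ _                = 0F

  reserved : V (μ 1 P₅) → V (μ 1 P₅) → Maybe (Fin 4 × Fin 4)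
  reserved (just (1F , 0F)) (just (2F , 0F)) = just (0F , 1F)
  reserved (just (1F , 0F)) (just (0F , 0F)) = just (0F , 2F)
  reserved (just (0F , 0F)) nothing          = just (0F , 2F)
  reserved nothing          (just (4F , 0F)) = just (0F , 2F)
  reserved (just (4F , 0F)) (just (3F , 0F)) = just (0F , 2F)
  reserved (just (1F , 0F)) nothing          = just (0F , 3F)
  reserved (just (2F , 0F)) (just (3F , 0F)) = just (1F , 2F)
  reserved (just (2F , 0F)) nothing          = just (1F , 3F)
  reserved (just (3F , 0F)) nothing          = just (2F , 3F)
  reserved _                _                = nothing

  open Labelling {μ _ P₅} _≟ᵥ_ (either-way reserved)

  routes : (i j : Fin 4) → i <ᶠ j → LabelledPath (φ i) (φ j) (i , j)
  routes 0F 1F _ = labelled-path (φ 0F ⟶⟨ level0 (inj₁ refl) refl refl ⟩ [ φ 1F ])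
  routes 0F 2F _ = labelled-path
    (φ 0F ⟶⟨ level0 (inj₂ refl) refl refl ⟩ just (0F , 0F) ⟶⟨ toW refl ⟩ nothing ⟶⟨ fromW refl ⟩
     just (4F , 0F) ⟶⟨ level0 (inj₂ refl) refl refl ⟩ [ φ 2F ])
  routes 0F 3F _ = labelled-path (φ 0F ⟶⟨ toW refl ⟩ [ φ 3F ])
  routes 1F 2F _ = labelled-path (φ 1F ⟶⟨ level0 (inj₁ refl) refl refl ⟩ [ φ 2F ])
  routes 1F 3F _ = labelled-path (φ 1F ⟶⟨ toW refl ⟩ [ φ 3F ])
  routes 2F 3F _ = labelled-path (φ 2F ⟶⟨ toW refl ⟩ [ φ 3F ])
  routes _                   0F ()
  routes (suc _)             1F (s≤s ())
  routes (suc (suc _))       2F (s≤s (s≤s ()))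
  routes (suc (suc (suc _))) 3F (s≤s (s≤s (s≤s ())))

K₄-in-μ₂ : KImmersion (μ 2 P₅) 4
K₄-in-μ₂ = labelled-immersion φ ψ (λ { 0F → refl ; 1F → refl ; 2F → refl ; 3F → refl }) routes
  where
  φ : Fin 4 → V (μ 2 P₅)
  φ 0F = just (1F , 0F)
  φ 1F = just (1F , 1F)
  φ 2F = just (2F , 0F)
  φ 3F = just (2F , 1F)

  ψ : V (μ 2 P₅) → Fin 4
  ψ (just (1F , 1F)) = 1F
  ψ (just (2F , 0F)) = 2F
  ψ (just (2F , 1F)) = 3F
  ψ _                = 0F

  reserved : V (μ 2 P₅) → V (μ 2 P₅) → Maybe (Fin 4 × Fin 4)
  reserved (just (1F , 0F)) (just (0F , 0F)) = just (0F , 1F)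
  reserved (just (0F , 0F)) (just (1F , 1F)) = just (0F , 1F)
  reserved (just (1F , 0F)) (just (2F , 0F)) = just (0F , 2F)
  reserved (just (1F , 0F)) (just (2F , 1F)) = just (0F , 3F)
  reserved (just (1F , 1F)) (just (2F , 0F)) = just (1F , 2F)
  reserved (just (1F , 1F)) nothing          = just (1F , 3F)
  reserved nothing          (just (2F , 1F)) = just (1F , 3F)
  reserved (just (2F , 0F)) (just (3F , 0F)) = just (2F , 3F)
  reserved (just (3F , 0F)) (just (2F , 1F)) = just (2F , 3F)
  reserved _                _                = nothing

  open Labelling {μ _ P₅} _≟ᵥ_ (either-way reserved)

  routes : (i j : Fin 4) → i <ᶠ j → LabelledPath (φ i) (φ j) (i , j)
  routes 0F 1F _ = labelled-path
    (φ 0F ⟶⟨ level0 (inj₂ refl) refl refl ⟩ just (0F , 0F) ⟶⟨ up (inj₁ refl) refl ⟩ [ φ 1F ])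
  routes 0F 2F _ = labelled-path (φ 0F ⟶⟨ level0 (inj₁ refl) refl refl ⟩ [ φ 2F ])
  routes 0F 3F _ = labelled-path (φ 0F ⟶⟨ up (inj₁ refl) refl ⟩ [ φ 3F ])
  routes 1F 2F _ = labelled-path (φ 1F ⟶⟨ down (inj₁ refl) refl ⟩ [ φ 2F ])
  routes 1F 3F _ = labelled-path (φ 1F ⟶⟨ toW refl ⟩ nothing ⟶⟨ fromW refl ⟩ [ φ 3F ])
  routes 2F 3F _ = labelled-path
    (φ 2F ⟶⟨ level0 (inj₁ refl) refl refl ⟩ just (3F , 0F) ⟶⟨ up (inj₂ refl) refl ⟩ [ φ 3F ])
  routes _                   0F ()
  routes (suc _)             1F (s≤s ())
  routes (suc (suc _))       2F (s≤s (s≤s ()))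
  routes (suc (suc (suc _))) 3F (s≤s (s≤s (s≤s ())))

odd : ℕ → Bool
odd zero    = false
odd (suc n) = not (odd n)

module K₅-in-μ (k : ℕ) where

  m : ℕ
  m = 3 + k

  open Ladder {P₅} P₅-sym m

  -- The ladders of the routes 0–4, 1–4 alternate between the columns 0, 1 and those of 2–4, 3–4 between
  -- 3, 4, so the parity of the level tells which ladder passes through (u , l).  Above level 1, column 2
  -- is only used by route 1–3, at (2 , 2).
  ladder-route : Fin 5 → Bool → Fin 5 × Fin 5
  ladder-route 0F true  = 0F , 4F
  ladder-route 1F false = 0F , 4F
  ladder-route 1F true  = 1F , 4F
  ladder-route 0F false = 1F , 4F
  ladder-route 3F true  = 2F , 4F
  ladder-route 4F false = 2F , 4F
  ladder-route 4F true  = 3F , 4F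
  ladder-route 3F false = 3F , 4F
  ladder-route 2F _     = 1F , 3F

  ladder-label : Fin 5 → Fin m → Maybe (Fin 5 × Fin 5)
  ladder-label u l = just (ladder-route u (odd (toℕ l)))

  reserved : V (μ m P₅) → V (μ m P₅) → Maybe (Fin 5 × Fin 5)
  reserved (just (1F , 0F)) (just (0F , 0F)) = just (0F , 1F)
  reserved (just (0F , 0F)) (just (1F , 1F)) = just (0F , 1F)
  reserved (just (1F , 0F)) (just (2F , 0F)) = just (0F , 2F)
  reserved (just (1F , 0F)) (just (2F , 1F)) = just (0F , 3F)
  reserved (just (2F , 1F)) (just (3F , 0F)) = just (0F , 3F)
  reserved (just (1F , 0F)) (just (0F , 1F)) = just (0F , 4F)
  reserved (just (1F , 1F)) (just (2F , 0F)) = just (1F , 2F)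
  reserved (just (3F , 1F)) (just (4F , 0F)) = just (1F , 3F)
  reserved (just (4F , 0F)) (just (3F , 0F)) = just (1F , 3F)
  reserved (just (2F , 0F)) (just (3F , 0F)) = just (2F , 3F)
  reserved (just (2F , 0F)) (just (3F , 1F)) = just (2F , 4F)
  reserved (just (3F , 0F)) (just (4F , 1F)) = just (3F , 4F)
  reserved _                _                = nothing

  label : V (μ m P₅) → V (μ m P₅) → Maybe (Fin 5 × Fin 5)
  label nothing                      (just (v , j))                = ladder-label v j
  label (just (u , i))               nothing                       = ladder-label u i
  label (just (u , i@(suc (suc _)))) _                             = ladder-label u i
  label _                            (just (v , j@(suc (suc _)))) = ladder-label v j
  label x                            y                             = either-way reserved x y

  open Labelling {μ m P₅} _≟ᵥ_ label

  rising-edge : ∀ {u v p} {i j : Fin m} → 1 ≤ toℕ i → toℕ j ≡ suc (toℕ i) →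
                ladder-label u i ≡ just p → ladder-label v j ≡ just p →
                label (just (u , i)) (just (v , j)) ≡ just p × label (just (v , j)) (just (u , i)) ≡ just p
  rising-edge {i = suc zero}    {j = suc (suc _)} _ _ _  at-j = at-j , at-j
  rising-edge {i = suc (suc _)} {j = suc (suc _)} _ _ at-i at-j = at-i , at-j
  rising-edge {i = zero}                          () _ _ _
  rising-edge {i = suc zero}    {j = zero}        _ () _ _
  rising-edge {i = suc zero}    {j = suc zero}    _ () _ _
  rising-edge {i = suc (suc _)} {j = zero}        _ () _ _
  rising-edge {i = suc (suc _)} {j = suc zero}    _ () _ _

  ladder-labelled : ∀ {a b p} (ab : Adj P₅ a b) (i : Fin m) d top → 1 ≤ toℕ i →
                    ladder-route a (odd (toℕ i)) ≡ p → ladder-route b (not (odd (toℕ i))) ≡ p →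
                    Labelled p (ladder ab i d top)
  ladder-labelled ab i zero    top _   at-a _    = (cong just at-a , cong just at-a) , tt
  ladder-labelled {a} {b} ab i (suc d) top 1≤i at-a at-b =
    rising-edge 1≤i (toℕ-next-level i d top) (cong just at-a) (cong just at-b′) ,
    ladder-labelled (P₅-sym ab) (next-level i d top) d (next-level-top i d top) 1≤next at-b′ at-a′
    where
    parity-flips : odd (toℕ (next-level i d top)) ≡ not (odd (toℕ i))
    parity-flips = cong odd (toℕ-next-level i d top)
    at-b′ : ladder-route b (odd (toℕ (next-level i d top))) ≡ _
    at-b′ = trans (cong (ladder-route b) parity-flips) at-b
    at-a′ : ladder-route a (not (odd (toℕ (next-level i d top)))) ≡ _
    at-a′ = trans (cong (ladder-route a ∘ not) parity-flips) (trans (cong (ladder-route a) (not-involutive _)) at-a)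
    1≤next : 1 ≤ toℕ (next-level i d top)
    1≤next = subst (1 ≤_) (sym (toℕ-next-level i d top)) (s≤s z≤n)

  ladder-path : ∀ {a b p} (ab : Adj P₅ a b) → ladder-route a true ≡ p → ladder-route b false ≡ p →
                LabelledPath (just (a , 1F)) nothing p
  ladder-path ab at-a at-b =
    record { walk = ladder ab 1F (suc k) refl ; distinct = ladder-unique ab 1F (suc k) refl } ,
    ladder-labelled ab 1F (suc k) refl (s≤s z≤n) at-a at-b

  onto-ladder : ∀ {u a b p} (e : MycAdj P₅ m (just (u , 0F)) (just (a , 1F))) (ab : Adj P₅ a b) →
                label (just (u , 0F)) (just (a , 1F)) ≡ just p × label (just (a , 1F)) (just (u , 0F)) ≡ just p →
                ladder-route a true ≡ p → ladder-route b false ≡ p → LabelledPath (just (u , 0F)) nothing p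
  onto-ladder e ab at-e at-a at-b =
    record { walk     = e ∷ ladder ab 1F (suc k) refl
           ; distinct = below-ladder ab 1F (suc k) refl (s≤s z≤n) ∷ ladder-unique ab 1F (suc k) refl } ,
    at-e , ladder-labelled ab 1F (suc k) refl (s≤s z≤n) at-a at-b

  φ : Fin 5 → V (μ m P₅)
  φ 0F = just (1F , 0F)
  φ 1F = just (1F , 1F)
  φ 2F = just (2F , 0F)
  φ 3F = just (3F , 0F)
  φ 4F = nothing

  ψ : V (μ m P₅) → Fin 5
  ψ (just (1F , 1F)) = 1F
  ψ (just (2F , 0F)) = 2F
  ψ (just (3F , 0F)) = 3F
  ψ nothing          = 4F
  ψ _                = 0F

  routes : (i j : Fin 5) → i <ᶠ j → LabelledPath (φ i) (φ j) (i , j)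
  routes 0F 1F _ = labelled-path
    (φ 0F ⟶⟨ level0 (inj₂ refl) refl refl ⟩ just (0F , 0F) ⟶⟨ up (inj₁ refl) refl ⟩ [ φ 1F ])
  routes 0F 2F _ = labelled-path (φ 0F ⟶⟨ level0 (inj₁ refl) refl refl ⟩ [ φ 2F ])
  routes 0F 3F _ = labelled-path (φ 0F ⟶⟨ up (inj₁ refl) refl ⟩ just (2F , 1F) ⟶⟨ down (inj₁ refl) refl ⟩ [ φ 3F ])
  routes 0F 4F _ = onto-ladder (up (inj₂ refl) refl) (inj₁ refl) (refl , refl) refl refl
  routes 1F 2F _ = labelled-path (φ 1F ⟶⟨ down (inj₁ refl) refl ⟩ [ φ 2F ])
  routes 1F 3F _ = labelled-path
    (φ 1F ⟶⟨ up (inj₁ refl) refl ⟩ just (2F , 2F) ⟶⟨ down (inj₁ refl) refl ⟩ just (3F , 1F) ⟶⟨ down (inj₁ refl) refl ⟩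
     just (4F , 0F) ⟶⟨ level0 (inj₂ refl) refl refl ⟩ [ φ 3F ])
  routes 1F 4F _ = ladder-path (inj₂ refl) refl refl
  routes 2F 3F _ = labelled-path (φ 2F ⟶⟨ level0 (inj₁ refl) refl refl ⟩ [ φ 3F ])
  routes 2F 4F _ = onto-ladder (up (inj₁ refl) refl) (inj₁ refl) (refl , refl) refl refl
  routes 3F 4F _ = onto-ladder (up (inj₁ refl) refl) (inj₂ refl) (refl , refl) refl refl
  routes _                         0F ()
  routes (suc _)                   1F (s≤s ())
  routes (suc (suc _))             2F (s≤s (s≤s ()))
  routes (suc (suc (suc _)))       3F (s≤s (s≤s (s≤s ())))
  routes (suc (suc (suc (suc _)))) 4F (s≤s (s≤s (s≤s (s≤s ()))))

  immersion : KImmersion (μ m P₅) 5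
  immersion = labelled-immersion φ ψ (λ { 0F → refl ; 1F → refl ; 2F → refl ; 3F → refl ; 4F → refl }) routes

proposition3 : ImmersionNumberIs (μ 1 P₅) 4 × ImmersionNumberIs (μ 2 P₅) 4 ×
                 ((m : ℕ) → 3 ≤ m → ImmersionNumberIs (μ m P₅) 5)
proposition3 = (K₄-in-μ₁ , λ _ → im-μ₁≤4) , (K₄-in-μ₂ , λ _ → im-μ₂≤4) , from-three-levels
  where
  from-three-levels : (m : ℕ) → 3 ≤ m → ImmersionNumberIs (μ m P₅) 5
  from-three-levels (suc (suc (suc k))) _             = K₅-in-μ.immersion k , λ _ → im-μ≤5
  from-three-levels (suc (suc zero))    (s≤s (s≤s ()))
  from-three-levels (suc zero)          (s≤s ())
  from-three-levels zero                ()
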